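{- Let $\mathcal V_z=\langle A,a_z,\delta,\vec x_{in}\rangle$ be a VASZ of dimension $d$ with $\delta(a_z)\in\{0\}\times\mathbb Z^{d-1}$, and let $\vec f=(0,\omega,\dots,\omega)$. The binary relation $\rightsquigarrow$ on $\{0\}\times\mathbb N_\omega^{d-1}$ defined by $\vec x\rightsquigarrow\vec y$ iff $\vec y\in\downarrow_{\vec f}\mathrm{Lim}\,\mathrm{Post}^*(\mathcal V_z(\vec x))$ is reflexive and transitive.
   Context: A VASZ of dimension $d$ is $\langle A,a_z,\delta,\vec x_{in}\rangle$ with $A$ finite, $a_z\notin A$, $\delta:A\cup\{a_z\}\to\mathbb Z^d$. States lie in $\mathbb N_\omega^d$ ($\mathbb N_\omega=\mathbb N\cup\{\omega\}$, $n\le\omega$, $\omega+n=n+\omega=\omega$ for $n\in\mathbb Z$): $\vec x\xrightarrow{a}\vec y$ iff $\vec y=\vec x+\delta(a)\ge\vec 0$ for $a\in A$, and $\vec x\xrightarrow{a_z}\vec y$ iff $\vec y=\vec x+\delta(a_z)\ge\vec0$ and $\vec x(1)=0$; extended to words. $\mathcal V_z(\vec x)$ is $\mathcal V_z$ with initial state $\vec x$, and $\mathrm{Post}^*(\mathcal V_z(\vec x))$ its set of reachable states. $\downarrow$ is downward closure for the componentwise order on $\mathbb N_\omega^d$. $\vec M|_{\vec f}=\{\vec x\in\vec M\mid\forall i,\ \vec f(i)<\omega\Rightarrow\vec x(i)=\vec f(i)\}$, $\downarrow_{\vec f}\vec M=\downarrow(\vec M|_{\vec f})$. Convergence in $\mathbb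 N_\omega$: ultimately constant equal to $\ell$, or integer subsequence infinite tending to infinity with $\ell=\omega$; componentwise in $\mathbb N_\omega^d$; $\mathrm{Lim}\,\vec M$ is the set of limits of sequences from $\vec M$. -}

module Defs where

open import Data.Nat using (ℕ; zero; suc) renaming (_≤_ to _≤ℕ_)
open import Data.Integer using (ℤ; +_; _+_)
open import Data.Fin using (Fin; zero; suc)
open import Data.Product using (Σ; ∃; _×_; _,_)
open import Data.Sum using (_⊎_)
open import Data.Unit using (⊤)
open import Data.Empty using (⊥)
open import Relation.Nullary using (¬_)
open import Relation.Binary.PropositionalEquality using (_≡_)
open import Relation.Binary.Construct.Closure.ReflexiveTransitive using (Star)

data ℕω : Set where
  fin : ℕ → ℕω
  ω   : ℕω

data _≤ω_ : ℕω → ℕω → Set where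
  fin≤fin : ∀ {m n} → m ≤ℕ n → fin m ≤ω fin n
  _≤ω-top : ∀ x → x ≤ω ω

IsFin : ℕω → Set
IsFin (fin _) = ⊤
IsFin ω = ⊥

-- States of dimension d: elements of ℕ_ω^d (coordinates indexed by Fin d;
-- coordinate "1" of the paper is Fin index zero).
State : ℕ → Set
State d = Fin d → ℕω

_≤ₛ_ : ∀ {d} → State d → State d → Set
x ≤ₛ y = ∀ i → x i ≤ω y i

SetOf : ℕ → Set₁
SetOf d = State d → Set

-- AddRel x z y : y = x + z (in ℕ_ω, with ω + z = ω), and y ≥ 0
-- (non-negativity is automatic since y ∈ ℕ_ω).
AddRel : ℕω → ℤ → ℕω → Set
AddRel (fin n) z (fin m) = + m ≡ (+ n) + z
AddRel (fin n) z ω = ⊥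
AddRel ω z (fin m) = ⊥
AddRel ω z ω = ⊤

-- A VASZ of dimension (suc d) (dimension ≥ 1 since coordinate 1 is zero-tested).
-- The finite action set A is Fin k; a_z is a separate action.
record VASZ (d : ℕ) : Set where
  field
    k   : ℕ
    δ   : Fin k → Fin (suc d) → ℤ
    δz  : Fin (suc d) → ℤ
    xin : State (suc d)
open VASZ public

Step : ∀ {d} → VASZ d → State (suc d) → State (suc d) → Set
Step V x y =
  (Σ (Fin (k V)) λ a → ∀ i → AddRel (x i) (δ V a i) (y i))
  ⊎ (x zero ≡ fin 0 × (∀ i → AddRel (x i) (δz V i) (y i)))

Post* : ∀ {d} → VASZ d → State (suc d) → SetOf (suc d)
Post* V x y = Star (Step V) x y

ConvergesTo : (ℕ → ℕω) → ℕω → Set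
ConvergesTo s ℓ =
  (∃ λ N → ∀ n → N ≤ℕ n → s n ≡ ℓ)
  ⊎ ( ℓ ≡ ω
    × (∀ N → ∃ λ n → N ≤ℕ n × IsFin (s n))
    × (∀ B → ∃ λ N → ∀ n → N ≤ℕ n → IsFin (s n) → fin B ≤ω s n))

ConvergesToₛ : ∀ {d} → (ℕ → State d) → State d → Set
ConvergesToₛ s ℓ = ∀ i → ConvergesTo (λ n → s n i) (ℓ i)

Lim : ∀ {d} → SetOf d → SetOf d
Lim M ℓ = ∃ λ (s : ℕ → State _) → (∀ n → M (s n)) × ConvergesToₛ s ℓ

Restrict : ∀ {d} → SetOf d → State d → SetOf d
Restrict M f x = M x × (∀ i → IsFin (f i) → x i ≡ f i)

↓ : ∀ {d} → SetOf d → SetOf d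
↓ M x = ∃ λ y → M y × x ≤ₛ y

↓[_] : ∀ {d} → State d → SetOf d → SetOf d
↓[ f ] M = ↓ (Restrict M f)

fvec : ∀ {d} → State (suc d)
fvec zero = fin 0
fvec (suc _) = ω

_⊢_⇝_ : ∀ {d} → VASZ d → State (suc d) → State (suc d) → Set
V ⊢ x ⇝ y = ↓[ fvec ] (Lim (Post* V x)) y

InDom : ∀ {d} → State (suc d) → Set
InDom x = x zero ≡ fin 0

module Submission where

-- Reflexivity is witnessed by the constant sequence x, x, x, ...
--
-- Let  s_m ∈ Post*(x)  converge to  y' ≥ y  and  t_n ∈ Post*(y)
-- converge to  z' ≥ z,  with  y'(1) = y(1) = z'(1) = 0.  For every n we replay
-- the run  y →* t_n  from a state  s_{m_n}  close enough to y', written as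
-- s_{m_n} = y + g_n  (g_n is ω where s_{m_n} is ω, and g_n(1) = 0).  The
-- replay (module Runs) combines two facts about a single update:
--   * monotonicity: adding g to source and target keeps it an update;
--   * ω-instantiation: it can be performed on any approximation of the source
--     that is ≥ |z| + B on its ω-coordinates, giving a level-B approximation.
-- The targets  v_n ∈ Post*(x)  converge to  ℓ = z' + (y' − y)
-- (coordinate-limit):  where y'(i) is finite,  v_n(i) = t_n(i) + (y'(i) − y(i));
-- where y'(i) = ω,  v_n(i) ≥ n, and since runs preserve which coordinates are
-- finite this sequence is entirely finite or constantly ω, so it tends to ω.
-- Finally ℓ(1) = 0 and z ≤ z' ≤ ℓ (module Transitivity).

open import Defs
open import Data.Nat using (ℕ)
open import Data.Integer using (+_)
open import Data.Fin using (zero)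
open import Data.Product using (_×_)
open import Relation.Binary.PropositionalEquality using (_≡_)

open import Data.Nat using (suc; _+_; _∸_; _⊔_; _≤_)
open import Data.Nat.Properties
  using (≤-refl; ≤-trans; ≤-reflexive; +-comm; +-assoc; m≤m+n; m≤n+m; m≤m⊔n; m≤n⊔m;
         +-monoˡ-≤; +-monoʳ-≤; m+n≤o⇒m≤o; m+n≤o⇒n≤o; m+n≤o⇒m≤o∸n; m+[n∸m]≡n)
open import Data.Integer as ℤ using (ℤ; -[1+_]; ∣_∣)
open import Data.Integer.Properties as ℤP using (pos-+; ⊖-≥)
open import Data.Fin using (Fin; suc)
open import Data.Product using (∃; _,_; proj₁; proj₂)
open import Data.Sum using (_⊎_; inj₁; inj₂)
open import Data.Unit using (⊤; tt)
open import Data.Empty using (⊥)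
open import Relation.Binary.PropositionalEquality using (refl; sym; trans; cong; cong₂; subst; module ≡-Reasoning)
open import Relation.Binary.Construct.Closure.ReflexiveTransitive using (Star; ε; _◅_; _◅◅_)

≤ω-refl : ∀ a → a ≤ω a
≤ω-refl (fin n) = fin≤fin ≤-refl
≤ω-refl ω = ω ≤ω-top

≤ω-trans : ∀ {a b c} → a ≤ω b → b ≤ω c → a ≤ω c
≤ω-trans (fin≤fin p) (fin≤fin q) = fin≤fin (≤-trans p q)
≤ω-trans p (_ ≤ω-top) = _ ≤ω-top

infixl 30 _⊕_ _⊕ₛ_

_⊕_ : ℕω → ℕω → ℕω
fin a ⊕ fin b = fin (a + b)
fin _ ⊕ ω = ω
ω ⊕ _ = ω

_⊕ₛ_ : ∀ {d} → State d → State d → State d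
(p ⊕ₛ c) i = p i ⊕ c i

⊕-ωʳ : ∀ a → a ⊕ ω ≡ ω
⊕-ωʳ (fin _) = refl
⊕-ωʳ ω = refl

≤ω-⊕ : ∀ a c → a ≤ω a ⊕ c
≤ω-⊕ (fin a) (fin c) = fin≤fin (m≤m+n a c)
≤ω-⊕ (fin a) ω = fin a ≤ω-top
≤ω-⊕ ω c = ω ≤ω-top

add-addrel : ∀ {a z b} c → AddRel a z b → AddRel (a ⊕ c) z (b ⊕ c)
add-addrel {fin n} {z} {fin m} (fin k) h = begin
    + (m + k)              ≡⟨ pos-+ m k ⟩
    + m ℤ.+ + k            ≡⟨ cong (ℤ._+ + k) h ⟩
    + n ℤ.+ z ℤ.+ + k      ≡⟨ ℤP.+-assoc (+ n) z (+ k) ⟩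
    + n ℤ.+ (z ℤ.+ + k)    ≡⟨ cong (λ w → + n ℤ.+ w) (ℤP.+-comm z (+ k)) ⟩
    + n ℤ.+ (+ k ℤ.+ z)    ≡⟨ sym (ℤP.+-assoc (+ n) (+ k) z) ⟩
    + n ℤ.+ + k ℤ.+ z      ≡⟨ cong (ℤ._+ z) (sym (pos-+ n k)) ⟩
    + (n + k) ℤ.+ z        ∎
  where open ≡-Reasoning
add-addrel {fin _} {_} {fin _} ω h = tt
add-addrel {ω} {_} {ω} c h = tt

-- This describes both a state "close" to the
-- limit of a sequence and the instantiation of ω-coordinates by big numbers.

Approx : ℕ → ℕω → ℕω → Set
Approx B (fin a) a' = a' ≡ fin a
Approx B ω a' = fin B ≤ω a'

ApproxS : ∀ {d} → ℕ → State d → State d → Set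
ApproxS B p p' = ∀ i → Approx B (p i) (p' i)

approx-refl : ∀ B a → Approx B a a
approx-refl B (fin _) = refl
approx-refl B ω = fin B ≤ω-top

approx-mono : ∀ {B B'} a {a'} → B ≤ B' → Approx B' a a' → Approx B a a'
approx-mono (fin _) _ e = e
approx-mono ω B≤B' h = ≤ω-trans (fin≤fin B≤B') h

approx-addrel : ∀ {B a z b a'} → AddRel a z b → Approx (∣ z ∣ + B) a a' →
  ∃ λ b' → AddRel a' z b' × Approx B b b'
approx-addrel {a = fin _} {b = fin m} h refl = fin m , h , refl
approx-addrel {a = ω} {b = ω} {a' = ω} h _ = ω , tt , _ ≤ω-top
approx-addrel {B} {ω} {+ k} {ω} {fin n} h (fin≤fin le) =
  fin (n + k) , pos-+ n k , fin≤fin (≤-trans (m+n≤o⇒n≤o k le) (m≤m+n n k))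
approx-addrel {B} {ω} { -[1+ k ]} {ω} {fin n} h (fin≤fin le) =
  fin (n ∸ suc k) , sym (⊖-≥ (m+n≤o⇒m≤o (suc k) le)) ,
  fin≤fin (m+n≤o⇒m≤o∸n B (subst (_≤ n) (+-comm (suc k) B) le))

maxOf : ∀ {n} → (Fin n → ℕ) → ℕ
maxOf {ℕ.zero} f = 0
maxOf {suc n} f = f zero ⊔ maxOf (λ i → f (suc i))

≤-maxOf : ∀ {n} (f : Fin n → ℕ) i → f i ≤ maxOf f
≤-maxOf f zero = m≤m⊔n _ _
≤-maxOf f (suc i) = ≤-trans (≤-maxOf (λ j → f (suc j)) i) (m≤n⊔m (f zero) _)

SameKind : ℕω → ℕω → Set
SameKind (fin _) (fin _) = ⊤
SameKind (fin _) ω = ⊥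
SameKind ω (fin _) = ⊥
SameKind ω ω = ⊤

sameKind-refl : ∀ a → SameKind a a
sameKind-refl (fin _) = tt
sameKind-refl ω = tt

sameKind-trans : ∀ a {b c} → SameKind a b → SameKind b c → SameKind a c
sameKind-trans (fin _) {fin _} {fin _} _ _ = tt
sameKind-trans ω {ω} {ω} _ _ = tt

addrel-sameKind : ∀ a {z} b → AddRel a z b → SameKind a b
addrel-sameKind (fin _) (fin _) _ = tt
addrel-sameKind ω ω _ = tt

sameKind-uniform : ∀ a (u : ℕ → ℕω) → (∀ n → SameKind a (u n)) →
  (∀ n → IsFin (u n)) ⊎ (∀ n → u n ≡ ω)
sameKind-uniform (fin a) u k = inj₁ λ n → fin-kind (u n) (k n)
  where
  fin-kind : ∀ b → SameKind (fin a) b → IsFin b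
  fin-kind (fin _) _ = tt
sameKind-uniform ω u k = inj₂ λ n → ω-kind (u n) (k n)
  where
  ω-kind : ∀ b → SameKind ω b → b ≡ ω
  ω-kind ω _ = refl

module Runs {d} (V : VASZ d) where

  step-sameKind : ∀ {p q} → Step V p q → ∀ i → SameKind (p i) (q i)
  step-sameKind {p} {q} (inj₁ (_ , h)) i = addrel-sameKind (p i) (q i) (h i)
  step-sameKind {p} {q} (inj₂ (_ , h)) i = addrel-sameKind (p i) (q i) (h i)

  run-sameKind : ∀ {p q} → Star (Step V) p q → ∀ i → SameKind (p i) (q i)
  run-sameKind {p} ε i = sameKind-refl (p i)
  run-sameKind {p} (st ◅ run) i = sameKind-trans (p i) (step-sameKind st i) (run-sameKind run i)

  replay-update : ∀ (z : Fin (suc d) → ℤ) {M p q} → (∀ i → ∣ z i ∣ ≤ M) →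
    (∀ i → AddRel (p i) (z i) (q i)) →
    ∀ B c p'' → ApproxS (M + B) (p ⊕ₛ c) p'' →
    ∃ λ q'' → (∀ i → AddRel (p'' i) (z i) (q'' i)) × ApproxS B (q ⊕ₛ c) q''
  replay-update z {p = p} {q} z≤M h B c p'' ap =
    (λ i → proj₁ (S i)) , (λ i → proj₁ (proj₂ (S i))) , (λ i → proj₂ (proj₂ (S i)))
    where
    S : ∀ i → ∃ λ b' → AddRel (p'' i) (z i) b' × Approx B (q i ⊕ c i) b'
    S i = approx-addrel (add-addrel (c i) (h i))
            (approx-mono (p i ⊕ c i) (+-monoˡ-≤ B (z≤M i)) (ap i))

  replay-step : ∀ {p q} → Step V p q → ∃ λ M → ∀ B c p'' → c zero ≡ fin 0 →
    ApproxS (M + B) (p ⊕ₛ c) p'' →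
    ∃ λ q'' → Step V p'' q'' × ApproxS B (q ⊕ₛ c) q''
  replay-step (inj₁ (a , h)) = maxOf |δ| , λ B c p'' _ ap →
    let (q'' , h'' , ap') = replay-update (δ V a) (≤-maxOf |δ|) h B c p'' ap
    in q'' , inj₁ (a , h'') , ap'
    where
    |δ| : Fin (suc d) → ℕ
    |δ| i = ∣ δ V a i ∣
  replay-step (inj₂ (p₀ , h)) = maxOf |δz| , λ B c p'' c₀ ap →
    let (q'' , h'' , ap') = replay-update (δz V) (≤-maxOf |δz|) h B c p'' ap
    in q'' , inj₂ (zero-tested p₀ c₀ (ap zero) , h'') , ap'
    where
    |δz| : Fin (suc d) → ℕ
    |δz| i = ∣ δz V i ∣
    zero-tested : ∀ {B a c a''} → a ≡ fin 0 → c ≡ fin 0 → Approx B (a ⊕ c) a'' → a'' ≡ fin 0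
    zero-tested refl refl e = e

  -- The same for runs; D bounds the total decrease along the run.

  replay-run : ∀ {p q} → Star (Step V) p q → ∃ λ D → ∀ B c p'' → c zero ≡ fin 0 →
    ApproxS (D + B) (p ⊕ₛ c) p'' →
    ∃ λ q'' → Star (Step V) p'' q'' × ApproxS B (q ⊕ₛ c) q''
  replay-run ε = 0 , λ B c p'' _ ap → p'' , ε , ap
  replay-run {p} (st ◅ run) with replay-step st | replay-run run
  ... | M , replay-st | D , replay-rest = M + D , λ B c p'' c₀ ap →
    let (q₁'' , st'' , ap₁) = replay-st (D + B) c p'' c₀ (subst (λ L → ApproxS L (p ⊕ₛ c) p'') (+-assoc M D B) ap)
        (q'' , run'' , ap') = replay-rest B c q₁'' c₀ ap₁
    in q'' , st'' ◅ run'' , ap'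

Eventually : (ℕ → Set) → Set
Eventually P = ∃ λ N → ∀ m → N ≤ m → P m

eventually-all : ∀ {n} (P : Fin n → ℕ → Set) → (∀ i → Eventually (P i)) →
  Eventually (λ m → ∀ i → P i m)
eventually-all {ℕ.zero} P ev = 0 , λ _ _ ()
eventually-all {suc n} P ev with ev zero | eventually-all (λ i → P (suc i)) (λ i → ev (suc i))
... | N₀ , h₀ | N , h = N₀ ⊔ N , λ
  { m le zero → h₀ m (≤-trans (m≤m⊔n N₀ N) le)
  ; m le (suc i) → h m (≤-trans (m≤n⊔m N₀ N) le) i }

converges⇒approx : ∀ {u ℓ} → ConvergesTo u ℓ → ∀ B → Eventually (λ m → Approx B ℓ (u m))
converges⇒approx {ℓ = ℓ} (inj₁ (N , h)) B =
  N , λ m le → subst (Approx B ℓ) (sym (h m le)) (approx-refl B ℓ)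
converges⇒approx {u} (inj₂ (refl , _ , tend)) B with tend B
... | N , h = N , λ m le → above (u m) (h m le)
  where
  above : ∀ a → (IsFin a → fin B ≤ω a) → fin B ≤ω a
  above (fin _) h = h tt
  above ω _ = fin B ≤ω-top

converges-shift : ∀ {u ℓ} c (v : ℕ → ℕω) → (∀ n → v n ≡ u n ⊕ fin c) →
  ConvergesTo u ℓ → ConvergesTo v (ℓ ⊕ fin c)
converges-shift c v e (inj₁ (N , h)) = inj₁ (N , λ n le → trans (e n) (cong (_⊕ fin c) (h n le)))
converges-shift {u} c v e (inj₂ (refl , inf , tend)) = inj₂ (refl , inf' , tend')
  where
  stays-fin : ∀ n → IsFin (u n) → IsFin (v n)
  stays-fin n f = subst IsFin (sym (e n)) (shifted (u n) f)
    where
    shifted : ∀ a → IsFin a → IsFin (a ⊕ fin c)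
    shifted (fin _) _ = tt
  grows : ∀ B n → (IsFin (u n) → fin B ≤ω u n) → fin B ≤ω v n
  grows B n h = subst (fin B ≤ω_) (sym (e n)) (shifted (u n) h)
    where
    shifted : ∀ a → (IsFin a → fin B ≤ω a) → fin B ≤ω a ⊕ fin c
    shifted (fin a) h = ≤ω-trans (h tt) (≤ω-⊕ (fin a) (fin c))
    shifted ω _ = _ ≤ω-top
  inf' : ∀ N → ∃ λ n → N ≤ n × IsFin (v n)
  inf' N = let (n , le , f) = inf N in n , le , stays-fin n f
  tend' : ∀ B → ∃ λ N → ∀ n → N ≤ n → IsFin (v n) → fin B ≤ω v n
  tend' B = let (N , h) = tend B in N , λ n le _ → grows B n (h n le)

approx-ω-converges : ∀ (v : ℕ → ℕω) → (∀ n → Approx n ω (v n)) →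
  (∀ n → IsFin (v n)) ⊎ (∀ n → v n ≡ ω) → ConvergesTo v ω
approx-ω-converges v big (inj₂ allω) = inj₁ (0 , λ n _ → allω n)
approx-ω-converges v big (inj₁ allFin) =
  inj₂ (refl , (λ N → N , ≤-refl , allFin N) ,
        λ B → B , λ n B≤n _ → ≤ω-trans (fin≤fin B≤n) (big n))

gap : ℕω → ℕω → ℕω
gap (fin s) (fin a) = fin (s ∸ a)
gap (fin _) ω = ω
gap ω _ = ω

⌊_⌋ : ℕω → ℕ
⌊ fin a ⌋ = a
⌊ ω ⌋ = 0

approx-gap : ∀ {a b σ B} → a ≤ω b → Approx (⌊ a ⌋ + B) b σ → Approx B (a ⊕ gap σ a) σ
approx-gap (fin≤fin a≤b) refl = cong fin (sym (m+[n∸m]≡n a≤b))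
approx-gap {σ = ω} (fin a ≤ω-top) _ = _ ≤ω-top
approx-gap {σ = fin s} (fin a ≤ω-top) (fin≤fin le) = cong fin (sym (m+[n∸m]≡n (m+n≤o⇒m≤o a le)))
approx-gap (ω ≤ω-top) h = h

gap-large : ∀ a σ τ {v B} → Approx (⌊ a ⌋ + B) ω σ → Approx B (τ ⊕ gap σ a) v → fin B ≤ω v
gap-large (fin a) (fin s) (fin k) {B = B} (fin≤fin le) refl =
  fin≤fin (≤-trans (m+n≤o⇒m≤o∸n B (≤-trans (≤-reflexive (+-comm B a)) le)) (m≤n+m (s ∸ a) k))
gap-large ω (fin _) (fin _) _ h = h
gap-large _ ω (fin _) _ h = h
gap-large _ _ ω _ h = h

-- One coordinate of the transitivity argument: a ≤ b (the coordinates of y,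
-- y'), σ_n approximates b, τ_n → ζ with τ_n reachable from a, and v_n
-- approximates τ_n + (σ_n − a).

coordinate-limit : ∀ {a b ζ} → a ≤ω b → (σ τ v : ℕ → ℕω) →
  (∀ n → Approx (⌊ a ⌋ + n) b (σ n)) → (∀ n → SameKind a (τ n)) → ConvergesTo τ ζ →
  (∀ n → Approx n (τ n ⊕ gap (σ n) a) (v n)) → (∀ n → IsFin (v n)) ⊎ (∀ n → v n ≡ ω) →
  ConvergesTo v (ζ ⊕ gap b a)
coordinate-limit {fin α} {fin β} (fin≤fin _) σ τ v σ≈b τ-kind τ→ζ v≈ _ =
  converges-shift (β ∸ α) v exact τ→ζ
  where
  exact : ∀ n → v n ≡ τ n ⊕ fin (β ∸ α)
  exact n with σ n | σ≈b n | τ n | τ-kind n | v≈ n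
  ... | .(fin β) | refl | fin k | _ | e = e
coordinate-limit {a} {ω} {ζ} _ σ τ v σ≈ω _ _ v≈ uniform =
  subst (ConvergesTo v) (sym (⊕-ωʳ ζ))
    (approx-ω-converges v (λ n → gap-large a (σ n) (τ n) (σ≈ω n) (v≈ n)) uniform)

fvec-restrict : ∀ {d} (w : State (suc d)) → w zero ≡ fin 0 → ∀ i → IsFin (fvec i) → w i ≡ fvec i
fvec-restrict w w₀ zero _ = w₀
fvec-restrict w w₀ (suc _) ()

⇝-refl : ∀ {d} (V : VASZ d) x → InDom x → V ⊢ x ⇝ x
⇝-refl V x x₀ =
  x , (((λ _ → x) , (λ _ → ε) , (λ i → inj₁ (0 , λ _ _ → refl))) , fvec-restrict x x₀) ,
  λ i → ≤ω-refl (x i)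

module Transitivity {d} (V : VASZ d) {x y y' z' : State (suc d)} {s t : ℕ → State (suc d)}
  (y₀ : y zero ≡ fin 0)
  (s-reach : ∀ m → Post* V x (s m)) (s-conv : ConvergesToₛ s y') (y'₀ : y' zero ≡ fin 0) (y≤y' : y ≤ₛ y')
  (t-reach : ∀ n → Post* V y (t n)) (t-conv : ConvergesToₛ t z') (z'₀ : z' zero ≡ fin 0) where

  open Runs V

  -- the decrease bound of the run  y →* t_n
  D : ℕ → ℕ
  D n = proj₁ (replay-run (t-reach n))

  -- an index m_n such that s_{m_n} approximates y' well enough to replay y →* t_n
  close : ∀ n → ∃ λ m → ∀ i → Approx (⌊ y i ⌋ + (D n + n)) (y' i) (s m i)
  close n =
    let (N , h) = eventually-all (λ i m → Approx (⌊ y i ⌋ + (D n + n)) (y' i) (s m i))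
                                 (λ i → converges⇒approx (s-conv i) (⌊ y i ⌋ + (D n + n)))
    in N , h N ≤-refl

  m : ℕ → ℕ
  m n = proj₁ (close n)

  -- s_{m_n} = y + g_n, and g_n leaves the zero-tested coordinate unchanged
  g : ℕ → State (suc d)
  g n i = gap (s (m n) i) (y i)

  g₀ : ∀ n → g n zero ≡ fin 0
  g₀ n = cong₂ gap (subst (λ b → Approx (⌊ y zero ⌋ + (D n + n)) b (s (m n) zero)) y'₀ (proj₂ (close n) zero)) y₀

  replayed : ∀ n → ∃ λ w → Star (Step V) (s (m n)) w × ApproxS n (t n ⊕ₛ g n) w
  replayed n = proj₂ (replay-run (t-reach n)) n (g n) (s (m n)) (g₀ n)
                 (λ i → approx-gap (y≤y' i) (proj₂ (close n) i))

  v : ℕ → State (suc d)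
  v n = proj₁ (replayed n)

  v-reach : ∀ n → Post* V x (v n)
  v-reach n = s-reach (m n) ◅◅ proj₁ (proj₂ (replayed n))

  ℓ : State (suc d)
  ℓ i = z' i ⊕ gap (y' i) (y i)

  v-conv : ConvergesToₛ v ℓ
  v-conv i = coordinate-limit (y≤y' i) (λ n → s (m n) i) (λ n → t n i) (λ n → v n i)
    (λ n → approx-mono (y' i) (+-monoʳ-≤ ⌊ y i ⌋ (m≤n+m n (D n))) (proj₂ (close n) i))
    (λ n → run-sameKind (t-reach n) i) (t-conv i)
    (λ n → proj₂ (proj₂ (replayed n)) i)
    (sameKind-uniform (x i) (λ n → v n i) (λ n → run-sameKind (v-reach n) i))

  ℓ₀ : ℓ zero ≡ fin 0
  ℓ₀ = cong₂ _⊕_ z'₀ (cong₂ gap y'₀ y₀)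

  reaches : ∀ z → z ≤ₛ z' → V ⊢ x ⇝ z
  reaches z z≤z' =
    ℓ , ((v , v-reach , v-conv) , fvec-restrict ℓ ℓ₀) , λ i → ≤ω-trans (z≤z' i) (≤ω-⊕ (z' i) _)

⇝-trans : ∀ {d} (V : VASZ d) x y z → InDom y → V ⊢ x ⇝ y → V ⊢ y ⇝ z → V ⊢ x ⇝ z
⇝-trans V x y z y₀ (y' , ((s , s-reach , s-conv) , y'-dom) , y≤y') (z' , ((t , t-reach , t-conv) , z'-dom) , z≤z') =
  Transitivity.reaches V y₀ s-reach s-conv (y'-dom zero tt) y≤y' t-reach t-conv (z'-dom zero tt) z z≤z'

-- Lemma 6.2.

lemma6p2 : ∀ {d} (V : VASZ d) → δz V zero ≡ + 0 →
    ((∀ x → InDom x → V ⊢ x ⇝ x)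
    × (∀ x y z → InDom x → InDom y → InDom z → V ⊢ x ⇝ y → V ⊢ y ⇝ z → V ⊢ x ⇝ z))
lemma6p2 V _ = ⇝-refl V , λ x y z _ y₀ _ → ⇝-trans V x y z y₀
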